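{- Let $\mathbf{P}\colon\mathsf{C}^{\mathrm{op}}\to\mathsf{BA}$ be a Boolean doctrine and $A=(A_X)_{X\in\mathsf{C}}$ a family with $A_X\subseteq\mathbf{P}(X)$. (1) The universal filter for $\mathbf{P}$ generated by $A$ is the family $(F_X)_{X\in\mathsf{C}}$ where $F_X$ is the set of $\varphi\in\mathbf{P}(X)$ for which there are $Y_1,\dots,Y_n\in\mathsf{C}$, $\alpha_1\in A_{Y_1},\dots,\alpha_n\in A_{Y_n}$ and morphisms $f_i\colon X\to Y_i$ ($i=1,\dots,n$) with $\bigwedge_{i=1}^n\mathbf{P}(f_i)(\alpha_i)\le\varphi$ in $\mathbf{P}(X)$. (2) The universal ideal for $\mathbf{P}$ generated by $A$ is the family $(I_X)_{X\in\mathsf{C}}$ where $I_X$ is the set of $\varphi\in\mathbf{P}(X)$ for which there are $Y_1,\dots,Y_n\in\mathsf{C}$, $\alpha_1\in A_{Y_1},\dots,\alpha_n\in A_{Y_n}$ and morphisms $f_j\colon\prod_{i=1}^nY_i\to X$ ($j=1,\dots,m$) with $\bigwedge_{j=1}^m\mathbf{P}(f_j)(\varphi)\le\bigvee_{i=1}^n\mathbf{P}(\mathrm{pr}_i)(\alpha_i)$ in $\mathbf{P}(\prod_{i=1}^nY_i)$.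
   Context: Categories have finite products; $\mathbf{t}$ terminal, $\mathrm{pr}_i$ projections (empty products are $\mathbf{t}$, empty meets are top, empty joins are bottom). A Boolean doctrine is a functor $\mathbf{P}\colon\mathsf{C}^{\mathrm{op}}\to\mathsf{BA}$. A universal filter for $\mathbf{P}$ is a family $(F_X)_{X\in\mathsf{C}}$, $F_X\subseteq\mathbf{P}(X)$, with $\mathbf{P}(f)(\alpha)\in F_X$ for all $f\colon X\to Y$ and $\alpha\in F_Y$, and each $F_X$ a filter. A universal ideal is a family $(I_X)$, $I_X\subseteq\mathbf{P}(X)$, with: (i) for $m\in\mathbb{N}$, $f_1,\dots,f_m\colon X\to Y$, $\alpha\in\mathbf{P}(Y)$, if $\bigwedge_{j=1}^m\mathbf{P}(f_j)(\alpha)\in I_X$ then $\alpha\in I_Y$; (ii) each $I_X$ downward closed; (iii) $\alpha_1\in I_{X_1}$, $\alpha_2\in I_{X_2}$ imply $\mathbf{P}(\mathrm{pr}_1)(\alpha_1)\lor\mathbf{P}(\mathrm{pr}_2)(\alpha_2)\in I_{X_1\times X_2}$; (iv) $\bot_{\mathbf{P}(\mathbf{t})}\in I_{\mathbf{t}}$. The universal filter (resp. ideal) generated by $A$ is the smallest universal filter (resp. ideal) componentwise containing $A$. -}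

module Defs where

open import Level using (Level; _⊔_) renaming (suc to lsuc)
open import Data.Nat using (ℕ; zero; suc)
open import Data.Fin using (Fin; zero; suc)
open import Data.Product using (Σ; _×_; _,_)
open import Relation.Unary using (Pred; _∈_)
open import Relation.Binary.PropositionalEquality using (_≡_)
open import Algebra.Lattice.Bundles using (BooleanAlgebra)

Car : ∀ {c ℓ} → BooleanAlgebra c ℓ → Set c
Car B = BooleanAlgebra.Carrier B

⋀ : ∀ {c ℓ} (B : BooleanAlgebra c ℓ) (n : ℕ) → (Fin n → Car B) → Car B
⋀ B zero    x = BooleanAlgebra.⊤ B
⋀ B (suc n) x = BooleanAlgebra._∧_ B (x zero) (⋀ B n (λ i → x (suc i)))

⋁ : ∀ {c ℓ} (B : BooleanAlgebra c ℓ) (n : ℕ) → (Fin n → Car B) → Car B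
⋁ B zero    x = BooleanAlgebra.⊥ B
⋁ B (suc n) x = BooleanAlgebra._∨_ B (x zero) (⋁ B n (λ i → x (suc i)))

-- (possibly improper) filter of a Boolean algebra
record IsFilter {c ℓ a} (B : BooleanAlgebra c ℓ) (F : Pred (Car B) a) : Set (c ⊔ ℓ ⊔ a) where
  open BooleanAlgebra B
  field
    ⊤∈     : ⊤ ∈ F
    upward : ∀ {x y} → x ∈ F → BooleanAlgebra._≈_ B (x ∧ y) x → y ∈ F
    ∧-closed : ∀ {x y} → x ∈ F → y ∈ F → (x ∧ y) ∈ F

record Category (o h : Level) : Set (lsuc (o ⊔ h)) where
  infixr 9 _∘_
  field
    Obj : Set o
    Hom : Obj → Obj → Set h
    id  : ∀ {X} → Hom X X
    _∘_ : ∀ {X Y Z} → Hom Y Z → Hom X Y → Hom X Z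
    identityˡ : ∀ {X Y} (f : Hom X Y) → id ∘ f ≡ f
    identityʳ : ∀ {X Y} (f : Hom X Y) → f ∘ id ≡ f
    assoc : ∀ {W X Y Z} (f : Hom W X) (g : Hom X Y) (k : Hom Y Z) → (k ∘ g) ∘ f ≡ k ∘ (g ∘ f)

record FPCategory (o h : Level) : Set (lsuc (o ⊔ h)) where
  field
    category : Category o h
  open Category category public
  field
    𝐭 : Obj
    ! : ∀ {X} → Hom X 𝐭
    !-unique : ∀ {X} (f : Hom X 𝐭) → f ≡ !
    _⊗_ : Obj → Obj → Obj
    π₁ : ∀ {X Y} → Hom (X ⊗ Y) X
    π₂ : ∀ {X Y} → Hom (X ⊗ Y) Y
    ⟨_,_⟩ : ∀ {Z X Y} → Hom Z X → Hom Z Y → Hom Z (X ⊗ Y)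
    π₁-β : ∀ {Z X Y} (f : Hom Z X) (g : Hom Z Y) → π₁ ∘ ⟨ f , g ⟩ ≡ f
    π₂-β : ∀ {Z X Y} (f : Hom Z X) (g : Hom Z Y) → π₂ ∘ ⟨ f , g ⟩ ≡ g
    ⟨⟩-η : ∀ {Z X Y} (k : Hom Z (X ⊗ Y)) → k ≡ ⟨ π₁ ∘ k , π₂ ∘ k ⟩

  Π : (n : ℕ) → (Fin n → Obj) → Obj
  Π zero    Y = 𝐭
  Π (suc n) Y = Y zero ⊗ Π n (λ i → Y (suc i))

  pr : (n : ℕ) (Y : Fin n → Obj) (i : Fin n) → Hom (Π n Y) (Y i)
  pr (suc n) Y zero    = π₁
  pr (suc n) Y (suc i) = pr n (λ j → Y (suc j)) i ∘ π₂

record BooleanDoctrine {o h} (C : FPCategory o h) (c ℓ : Level)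
       : Set (o ⊔ h ⊔ lsuc (c ⊔ ℓ)) where
  open FPCategory C
  field
    P   : Obj → BooleanAlgebra c ℓ
    map : ∀ {X Y} → Hom X Y → Car (P Y) → Car (P X)
    map-cong : ∀ {X Y} (f : Hom X Y) {x y} → BooleanAlgebra._≈_ (P Y) x y
             → BooleanAlgebra._≈_ (P X) (map f x) (map f y)
    map-∧ : ∀ {X Y} (f : Hom X Y) x y
          → BooleanAlgebra._≈_ (P X) (map f (BooleanAlgebra._∧_ (P Y) x y))
                                     (BooleanAlgebra._∧_ (P X) (map f x) (map f y))
    map-∨ : ∀ {X Y} (f : Hom X Y) x y
          → BooleanAlgebra._≈_ (P X) (map f (BooleanAlgebra._∨_ (P Y) x y))
                                     (BooleanAlgebra._∨_ (P X) (map f x) (map f y))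
    map-¬ : ∀ {X Y} (f : Hom X Y) x
          → BooleanAlgebra._≈_ (P X) (map f (BooleanAlgebra.¬_ (P Y) x))
                                     (BooleanAlgebra.¬_ (P X) (map f x))
    map-⊤ : ∀ {X Y} (f : Hom X Y)
          → BooleanAlgebra._≈_ (P X) (map f (BooleanAlgebra.⊤ (P Y))) (BooleanAlgebra.⊤ (P X))
    map-⊥ : ∀ {X Y} (f : Hom X Y)
          → BooleanAlgebra._≈_ (P X) (map f (BooleanAlgebra.⊥ (P Y))) (BooleanAlgebra.⊥ (P X))
    map-id : ∀ {X} x → BooleanAlgebra._≈_ (P X) (map (id {X}) x) x
    map-∘ : ∀ {X Y Z} (f : Hom X Y) (g : Hom Y Z) x
          → BooleanAlgebra._≈_ (P X) (map (g ∘ f) x) (map f (map g x))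

module _ {o h c ℓ} {C : FPCategory o h} (D : BooleanDoctrine C c ℓ) where
  open FPCategory C
  open BooleanDoctrine D

  _≤ₚ_ : ∀ {X} → Car (P X) → Car (P X) → Set ℓ
  _≤ₚ_ {X} x y = BooleanAlgebra._≈_ (P X) (BooleanAlgebra._∧_ (P X) x y) x

  Family : (a : Level) → Set (o ⊔ c ⊔ lsuc a)
  Family a = (X : Obj) → Pred (Car (P X)) a

  _⊆ᶠ_ : ∀ {a b} → Family a → Family b → Set (o ⊔ c ⊔ a ⊔ b)
  A ⊆ᶠ B = ∀ X {φ} → φ ∈ A X → φ ∈ B X

  record IsUniversalFilter {a} (F : Family a) : Set (o ⊔ h ⊔ c ⊔ ℓ ⊔ a) where
    field
      stable : ∀ {X Y} (f : Hom X Y) {α} → α ∈ F Y → map f α ∈ F X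
      filter : ∀ X → IsFilter (P X) (F X)

  record IsUniversalIdeal {a} (I : Family a) : Set (o ⊔ h ⊔ c ⊔ ℓ ⊔ a) where
    field
      -- (i)
      reflect : ∀ {X Y} (m : ℕ) (f : Fin m → Hom X Y) (α : Car (P Y))
              → ⋀ (P X) m (λ j → map (f j) α) ∈ I X → α ∈ I Y
      -- (ii)
      downward : ∀ {X} {x y : Car (P X)} → y ∈ I X → x ≤ₚ y → x ∈ I X
      -- (iii)
      ⊗-join : ∀ {X₁ X₂} {α₁ α₂} → α₁ ∈ I X₁ → α₂ ∈ I X₂
             → BooleanAlgebra._∨_ (P (X₁ ⊗ X₂)) (map π₁ α₁) (map π₂ α₂) ∈ I (X₁ ⊗ X₂)
      -- (iv)
      ⊥∈ : BooleanAlgebra.⊥ (P 𝐭) ∈ I 𝐭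

  -- G is the universal filter generated by A (at universe level g for competitors):
  -- G is a universal filter, contains A, and is contained in every universal
  -- filter containing A.
  record IsGeneratedUniversalFilter {a b} (g : Level) (A : Family a) (G : Family b)
         : Set (o ⊔ h ⊔ c ⊔ ℓ ⊔ a ⊔ b ⊔ lsuc g) where
    field
      isUniversalFilter : IsUniversalFilter G
      contains : A ⊆ᶠ G
      least : (F : Family g) → IsUniversalFilter F → A ⊆ᶠ F → G ⊆ᶠ F

  record IsGeneratedUniversalIdeal {a b} (g : Level) (A : Family a) (G : Family b)
         : Set (o ⊔ h ⊔ c ⊔ ℓ ⊔ a ⊔ b ⊔ lsuc g) where
    field
      isUniversalIdeal : IsUniversalIdeal G
      contains : A ⊆ᶠ G
      least : (I : Family g) → IsUniversalIdeal I → A ⊆ᶠ I → G ⊆ᶠ I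

  FilterOf : ∀ {a} → Family a → Family (o ⊔ h ⊔ c ⊔ ℓ ⊔ a)
  FilterOf A X φ =
    Σ ℕ λ n → Σ (Fin n → Obj) λ Y → Σ ((i : Fin n) → Car (P (Y i))) λ α →
      ((i : Fin n) → α i ∈ A (Y i)) ×
      Σ ((i : Fin n) → Hom X (Y i)) λ f →
        ⋀ (P X) n (λ i → map (f i) (α i)) ≤ₚ φ

  IdealOf : ∀ {a} → Family a → Family (o ⊔ h ⊔ c ⊔ ℓ ⊔ a)
  IdealOf A X φ =
    Σ ℕ λ n → Σ (Fin n → Obj) λ Y → Σ ((i : Fin n) → Car (P (Y i))) λ α →
      ((i : Fin n) → α i ∈ A (Y i)) ×
      Σ ℕ λ m → Σ (Fin m → Hom (Π n Y) X) λ f →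
        ⋀ (P (Π n Y)) m (λ j → map (f j) φ) ≤ₚ ⋁ (P (Π n Y)) n (λ i → map (pr n Y i) (α i))

{-# OPTIONS --safe #-}
module Submission where

-- Both descriptions come from one construction: the universal filter ⟨ S ⟩ᶠ generated by
-- elements αᵢ ∈ P(Yᵢ) consists of everything above a finite meet of reindexings P(f)(αᵢ);
-- part (1) is the case S = A. For (2), φ ∈ I_X says that the join ⋁[ gs ] of finitely many
-- generators, taken in their product Π[ gs ], lies in the universal filter generated by φ
-- alone. Axioms (i) and (ii) then follow from minimality of generated filters, and (iii) by
-- concatenating the two lists of generators and pairing reindexings:
-- P⟨f,g⟩(P(π₁)α₁ ∨ P(π₂)α₂) = P(f)α₁ ∨ P(g)α₂, and finite meets distribute over ∨.
-- Conversely, by (iii) and (iv) every universal ideal containing A contains each ⋁[ gs ],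
-- hence by (ii) and (i) every φ with such a witness.

open import Level using (Level; _⊔_; 0ℓ) renaming (suc to lsuc)
open import Data.Nat using (ℕ; zero; suc; _+_)
open import Data.Fin using (zero; suc)
open import Data.Unit.Polymorphic using (⊤; tt)
open import Data.Product using (Σ; _×_; _,_; proj₁; proj₂)
open import Data.Vec.Functional using (Vector; []; _∷_; head; tail)
open import Function using (_∘′_; const)
open import Relation.Unary using (Pred; _∈_)
open import Relation.Binary.PropositionalEquality using (_≡_; cong)
open import Relation.Binary.Bundles using (Poset)
open import Relation.Binary.Lattice using (Lattice)
import Relation.Binary.Lattice.Properties.MeetSemilattice as MeetSemilatticeProperties
import Relation.Binary.Lattice.Properties.JoinSemilattice as JoinSemilatticeProperties
import Relation.Binary.Reasoning.PartialOrder as ≤-Reasoning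
open import Algebra.Lattice.Bundles using (BooleanAlgebra)
import Algebra.Lattice.Properties.BooleanAlgebra as BooleanAlgebraProperties
import Algebra.Lattice.Properties.Lattice as LatticeProperties

open import Defs

infixr 5 _++_

-- Unlike Data.Vec.Functional._++_ this recurses on the first vector, so that Π and ⋁ over a
-- concatenation unfold definitionally.
_++_ : ∀ {a} {A : Set a} {m n} → Vector A m → Vector A n → Vector A (m + n)
_++_ {m = zero}  xs ys = ys
_++_ {m = suc m} xs ys = head xs ∷ (tail xs ++ ys)

module BooleanAlgebraOrder {c ℓ} (B : BooleanAlgebra c ℓ) where
  open BooleanAlgebra B
  open BooleanAlgebraProperties B using (∧-identityˡ; ∧-zeroˡ; ∨-zeroʳ)
  open LatticeProperties lattice public using (poset)
  open LatticeProperties lattice using (∨-∧-orderTheoreticLattice)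
  open Poset poset public using (_≤_)
    renaming (refl to ≤-refl; trans to ≤-trans; reflexive to ≤-reflexive)
  open Lattice ∨-∧-orderTheoreticLattice public using (x∧y≤x; x≤x∨y; y≤x∨y; ∨-least)
  open Lattice ∨-∧-orderTheoreticLattice using (meetSemilattice; joinSemilattice)
  open MeetSemilatticeProperties meetSemilattice public using (∧-monotonic)
  open JoinSemilatticeProperties joinSemilattice public using (∨-monotonic)

  x∧y≈x⇒x≤y : ∀ {x y} → x ∧ y ≈ x → x ≤ y
  x∧y≈x⇒x≤y = sym

  x≤y⇒x∧y≈x : ∀ {x y} → x ≤ y → x ∧ y ≈ x
  x≤y⇒x∧y≈x = sym

  ⊥≤x : ∀ x → ⊥ ≤ x
  ⊥≤x x = sym (∧-zeroˡ x)

  ⋀-cong : ∀ n {x y : Vector Carrier n} → (∀ i → x i ≈ y i) → ⋀ B n x ≈ ⋀ B n y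
  ⋀-cong zero    x≈y = refl
  ⋀-cong (suc n) x≈y = ∧-cong (x≈y zero) (⋀-cong n (λ i → x≈y (suc i)))

  ⋁-cong : ∀ n {x y : Vector Carrier n} → (∀ i → x i ≈ y i) → ⋁ B n x ≈ ⋁ B n y
  ⋁-cong zero    x≈y = refl
  ⋁-cong (suc n) x≈y = ∨-cong (x≈y zero) (⋁-cong n (λ i → x≈y (suc i)))

  ⋀-++ : ∀ {a} {A : Set a} (f : A → Carrier) m {n} (xs : Vector A m) (ys : Vector A n)
       → ⋀ B (m + n) (f ∘′ (xs ++ ys)) ≈ ⋀ B m (f ∘′ xs) ∧ ⋀ B n (f ∘′ ys)
  ⋀-++ f zero    xs ys = sym (∧-identityˡ _)
  ⋀-++ f (suc m) xs ys = trans (∧-congˡ (⋀-++ f m (tail xs) ys)) (sym (∧-assoc _ _ _))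

  ∨-distribˡ-⋀ : ∀ n x (y : Vector Carrier n) → x ∨ ⋀ B n y ≈ ⋀ B n (λ k → x ∨ y k)
  ∨-distribˡ-⋀ zero    x y = ∨-zeroʳ x
  ∨-distribˡ-⋀ (suc n) x y = trans (∨-distribˡ-∧ x _ _) (∧-congˡ (∨-distribˡ-⋀ n x (tail y)))

  ⋀∨⋀ : ∀ m n (x : Vector Carrier m) (y : Vector Carrier n)
      → ⋀ B m x ∨ ⋀ B n y ≈ ⋀ B m (λ j → ⋀ B n (λ k → x j ∨ y k))
  ⋀∨⋀ m n x y = trans (∨-comm _ _) (trans (∨-distribˡ-⋀ m (⋀ B n y) x)
    (⋀-cong m (λ j → trans (∨-comm _ _) (∨-distribˡ-⋀ n (x j) y))))

  ⋀-closed : ∀ {a} {F : Pred Carrier a} → IsFilter B F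
           → ∀ n {x : Vector Carrier n} → (∀ i → x i ∈ F) → ⋀ B n x ∈ F
  ⋀-closed isFilter zero    x∈F = IsFilter.⊤∈ isFilter
  ⋀-closed isFilter (suc n) x∈F =
    IsFilter.∧-closed isFilter (x∈F zero) (⋀-closed isFilter n (λ i → x∈F (suc i)))

module _ {o h c ℓ} {C : FPCategory o h} (D : BooleanDoctrine C c ℓ) where
  open FPCategory C
  open BooleanDoctrine D
  module B {X : Obj} = BooleanAlgebra (P X)
  open B using (_≈_; _∧_; _∨_)
  module O {X : Obj} = BooleanAlgebraOrder (P X)
  open O

  map-resp-≡ : ∀ {X Y} {f g : Hom X Y} → f ≡ g → ∀ x → map f x ≈ map g x
  map-resp-≡ f≡g x = B.reflexive (cong (λ k → map k x) f≡g)

  map-mono : ∀ {X Y} (f : Hom X Y) {x y} → x ≤ y → map f x ≤ map f y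
  map-mono f {x} {y} x≤y = B.trans (map-cong f x≤y) (map-∧ f x y)

  map-⋀ : ∀ {X Y} (f : Hom X Y) n (x : Vector (Car (P Y)) n)
        → map f (⋀ (P Y) n x) ≈ ⋀ (P X) n (map f ∘′ x)
  map-⋀ f zero    x = map-⊤ f
  map-⋀ f (suc n) x = B.trans (map-∧ f _ _) (B.∧-congˡ (map-⋀ f n (tail x)))

  map-⋁ : ∀ {X Y} (f : Hom X Y) n (x : Vector (Car (P Y)) n)
        → map f (⋁ (P Y) n x) ≈ ⋁ (P X) n (map f ∘′ x)
  map-⋁ f zero    x = map-⊥ f
  map-⋁ f (suc n) x = B.trans (map-∨ f _ _) (B.∨-congˡ (map-⋁ f n (tail x)))

  map-π₁-⟨,⟩ : ∀ {Z X Y} (f : Hom Z X) (g : Hom Z Y) x → map ⟨ f , g ⟩ (map π₁ x) ≈ map f x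
  map-π₁-⟨,⟩ f g x = B.trans (B.sym (map-∘ ⟨ f , g ⟩ π₁ x)) (map-resp-≡ (π₁-β f g) x)

  map-π₂-⟨,⟩ : ∀ {Z X Y} (f : Hom Z X) (g : Hom Z Y) y → map ⟨ f , g ⟩ (map π₂ y) ≈ map g y
  map-π₂-⟨,⟩ f g y = B.trans (B.sym (map-∘ ⟨ f , g ⟩ π₂ y)) (map-resp-≡ (π₂-β f g) y)

  module _ {a b} {F : Family D a} {G : Family D b} (F⊆G : _⊆ᶠ_ D F G) (G⊆F : _⊆ᶠ_ D G F) where

    IsUniversalFilter-resp : IsUniversalFilter D F → IsUniversalFilter D G
    IsUniversalFilter-resp isF = record
      { stable = λ f α∈G → F⊆G _ (stable f (G⊆F _ α∈G))
      ; filter = λ X → record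
        { ⊤∈       = F⊆G X (IsFilter.⊤∈ (filter X))
        ; upward   = λ x∈G x∧y≈x → F⊆G X (IsFilter.upward (filter X) (G⊆F X x∈G) x∧y≈x)
        ; ∧-closed = λ x∈G y∈G → F⊆G X (IsFilter.∧-closed (filter X) (G⊆F X x∈G) (G⊆F X y∈G))
        }
      }
      where open IsUniversalFilter isF

    IsUniversalIdeal-resp : IsUniversalIdeal D F → IsUniversalIdeal D G
    IsUniversalIdeal-resp isI = record
      { reflect  = λ m f α ⋀∈G → F⊆G _ (reflect m f α (G⊆F _ ⋀∈G))
      ; downward = λ y∈G x≤y → F⊆G _ (downward (G⊆F _ y∈G) x≤y)
      ; ⊗-join   = λ α₁∈G α₂∈G → F⊆G _ (⊗-join (G⊆F _ α₁∈G) (G⊆F _ α₂∈G))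
      ; ⊥∈       = F⊆G _ ⊥∈
      }
      where open IsUniversalIdeal isI

    IsGeneratedUniversalFilter-resp : ∀ {g c} {A : Family D c}
      → IsGeneratedUniversalFilter D g A F → IsGeneratedUniversalFilter D g A G
    IsGeneratedUniversalFilter-resp isGen = record
      { isUniversalFilter = IsUniversalFilter-resp isUniversalFilter
      ; contains          = λ X α∈A → F⊆G X (contains X α∈A)
      ; least             = λ F′ isF′ A⊆F′ X α∈G → least F′ isF′ A⊆F′ X (G⊆F X α∈G)
      }
      where open IsGeneratedUniversalFilter isGen

    IsGeneratedUniversalIdeal-resp : ∀ {g c} {A : Family D c}
      → IsGeneratedUniversalIdeal D g A F → IsGeneratedUniversalIdeal D g A G
    IsGeneratedUniversalIdeal-resp isGen = record
      { isUniversalIdeal = IsUniversalIdeal-resp isUniversalIdeal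
      ; contains         = λ X α∈A → F⊆G X (contains X α∈A)
      ; least            = λ I isI A⊆I X α∈G → least I isI A⊆I X (G⊆F X α∈G)
      }
      where open IsGeneratedUniversalIdeal isGen

  record Generators ι : Set (o ⊔ c ⊔ lsuc ι) where
    field
      Index : Set ι
      obj   : Index → Obj
      elt   : (i : Index) → Car (P (obj i))

  open Generators

  Instance : ∀ {ι} → Generators ι → Obj → Set (h ⊔ ι)
  Instance S Z = Σ (Index S) λ i → Hom Z (obj S i)

  value : ∀ {ι} (S : Generators ι) {Z} → Instance S Z → Car (P Z)
  value S (i , f) = map f (elt S i)

  ⟨_⟩ᶠ : ∀ {ι} → Generators ι → Family D (h ⊔ ℓ ⊔ ι)
  ⟨ S ⟩ᶠ Z z = Σ ℕ λ n → Σ (Vector (Instance S Z) n) λ is → ⋀ (P Z) n (value S ∘′ is) ≤ z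

  module _ {ι} (S : Generators ι) where

    ⟨⟩ᶠ-resp-≤ : ∀ {Z z z′} → z ∈ ⟨ S ⟩ᶠ Z → z ≤ z′ → z′ ∈ ⟨ S ⟩ᶠ Z
    ⟨⟩ᶠ-resp-≤ (n , is , ≤z) z≤z′ = n , is , ≤-trans ≤z z≤z′

    ⟨⟩ᶠ-instance : ∀ {Z} (i : Instance S Z) → value S i ∈ ⟨ S ⟩ᶠ Z
    ⟨⟩ᶠ-instance i = 1 , const i , x∧y≤x _ _

    ⟨⟩ᶠ-generator : ∀ i → elt S i ∈ ⟨ S ⟩ᶠ (obj S i)
    ⟨⟩ᶠ-generator i = ⟨⟩ᶠ-resp-≤ (⟨⟩ᶠ-instance (i , id)) (≤-reflexive (map-id (elt S i)))

    ⟨⟩ᶠ-stable : ∀ {Z W} (g : Hom W Z) {z} → z ∈ ⟨ S ⟩ᶠ Z → map g z ∈ ⟨ S ⟩ᶠ W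
    ⟨⟩ᶠ-stable g {z} (n , is , ≤z) = n , reindex ∘′ is , (begin
      ⋀ _ n (value S ∘′ reindex ∘′ is)      ≈⟨ ⋀-cong n (λ k → map-∘ g (proj₂ (is k)) _) ⟩
      ⋀ _ n (λ k → map g (value S (is k)))  ≈⟨ map-⋀ g n (value S ∘′ is) ⟨
      map g (⋀ _ n (value S ∘′ is))         ≤⟨ map-mono g ≤z ⟩
      map g z                               ∎)
      where
      open ≤-Reasoning poset
      reindex : Instance S _ → Instance S _
      reindex (i , f) = i , f ∘ g

    ⟨⟩ᶠ-∧ : ∀ {Z x y} → x ∈ ⟨ S ⟩ᶠ Z → y ∈ ⟨ S ⟩ᶠ Z → x ∧ y ∈ ⟨ S ⟩ᶠ Z
    ⟨⟩ᶠ-∧ (m , is , ≤x) (n , js , ≤y) =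
      m + n , is ++ js , ≤-trans (≤-reflexive (⋀-++ (value S) m is js)) (∧-monotonic ≤x ≤y)

    ⟨⟩ᶠ-isUniversalFilter : IsUniversalFilter D ⟨ S ⟩ᶠ
    ⟨⟩ᶠ-isUniversalFilter = record
      { stable = ⟨⟩ᶠ-stable
      ; filter = λ Z → record
        { ⊤∈       = 0 , [] , ≤-refl
        ; upward   = λ z∈ z∧z′≈z → ⟨⟩ᶠ-resp-≤ z∈ (x∧y≈x⇒x≤y z∧z′≈z)
        ; ∧-closed = ⟨⟩ᶠ-∧
        }
      }

    ⟨⟩ᶠ-least : ∀ {g} (F : Family D g) → IsUniversalFilter D F
              → (∀ i → elt S i ∈ F (obj S i)) → _⊆ᶠ_ D ⟨ S ⟩ᶠ F
    ⟨⟩ᶠ-least F isF gen∈F Z (n , is , ≤z) =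
      IsFilter.upward (filter Z) (⋀-closed (filter Z) n instance∈F) (x≤y⇒x∧y≈x ≤z)
      where
      open IsUniversalFilter isF
      instance∈F : ∀ k → value S (is k) ∈ F Z
      instance∈F k = stable (proj₂ (is k)) (gen∈F (proj₁ (is k)))

  singleton : ∀ {X} → Car (P X) → Generators 0ℓ
  singleton {X} φ = record { Index = ⊤ ; obj = const X ; elt = const φ }

  ⟨singleton⟩-⊆ : ∀ {X Y} {α : Car (P Y)} {ψ : Car (P X)}
                → ψ ∈ ⟨ singleton α ⟩ᶠ X → _⊆ᶠ_ D ⟨ singleton ψ ⟩ᶠ ⟨ singleton α ⟩ᶠ
  ⟨singleton⟩-⊆ {α = α} ψ∈ =
    ⟨⟩ᶠ-least (singleton _) ⟨ singleton α ⟩ᶠ (⟨⟩ᶠ-isUniversalFilter (singleton α)) (const ψ∈)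

  ⟨singleton⟩-⊗ : ∀ {Z X₁ X₂} {α₁ : Car (P X₁)} {α₂ : Car (P X₂)} {z₁ z₂ : Car (P Z)}
                → z₁ ∈ ⟨ singleton α₁ ⟩ᶠ Z → z₂ ∈ ⟨ singleton α₂ ⟩ᶠ Z
                → z₁ ∨ z₂ ∈ ⟨ singleton (map π₁ α₁ ∨ map π₂ α₂) ⟩ᶠ Z
  ⟨singleton⟩-⊗ {Z} {α₁ = α₁} {α₂} (m , is , ≤z₁) (n , js , ≤z₂) =
    ⟨⟩ᶠ-resp-≤ S (⋀-closed isFilter m (λ j → ⋀-closed isFilter n (λ k → pair∈ (is j) (js k))))
      (≤-trans (≤-reflexive (B.sym (⋀∨⋀ m n _ _))) (∨-monotonic ≤z₁ ≤z₂))
    where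
    S = singleton (map π₁ α₁ ∨ map π₂ α₂)
    isFilter = IsUniversalFilter.filter (⟨⟩ᶠ-isUniversalFilter S) Z
    pair∈ : ∀ i j → value (singleton α₁) i ∨ value (singleton α₂) j ∈ ⟨ S ⟩ᶠ Z
    pair∈ (_ , f) (_ , g) = ⟨⟩ᶠ-resp-≤ S (⟨⟩ᶠ-instance S (tt , ⟨ f , g ⟩)) (≤-reflexive
      (B.trans (map-∨ ⟨ f , g ⟩ _ _) (B.∨-cong (map-π₁-⟨,⟩ f g α₁) (map-π₂-⟨,⟩ f g α₂))))

  module GeneratorJoins {ι} (S : Generators ι) where

    Π[_] : ∀ {n} → Vector (Index S) n → Obj
    Π[_] {n} gs = Π n (obj S ∘′ gs)

    ⋁[_] : ∀ {n} (gs : Vector (Index S) n) → Car (P Π[ gs ])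
    ⋁[_] {n} gs = ⋁ (P Π[ gs ]) n (λ k → map (pr n (obj S ∘′ gs) k) (elt S (gs k)))

    ⋁[∷] : ∀ {n} g (gs : Vector (Index S) n) → ⋁[ g ∷ gs ] ≈ map π₁ (elt S g) ∨ map π₂ ⋁[ gs ]
    ⋁[∷] {n} g gs = B.∨-congˡ (B.trans
      (⋁-cong n (λ k → map-∘ π₂ (pr n (obj S ∘′ gs) k) (elt S (gs k))))
      (B.sym (map-⋁ π₂ n _)))

    _≼_ : ∀ {m n} → Vector (Index S) m → Vector (Index S) n → Set (h ⊔ ℓ)
    gs ≼ hs = Σ (Hom Π[ hs ] Π[ gs ]) λ u → map u ⋁[ gs ] ≤ ⋁[ hs ]

    []≼ : ∀ {n} (hs : Vector (Index S) n) → [] ≼ hs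
    []≼ hs = ! , ≤-trans (≤-reflexive (map-⊥ !)) (⊥≤x _)

    ≼-refl : ∀ {n} (gs : Vector (Index S) n) → gs ≼ gs
    ≼-refl gs = id , ≤-reflexive (map-id _)

    ≼-skip : ∀ {m n} (gs : Vector (Index S) m) h (hs : Vector (Index S) n)
           → gs ≼ hs → gs ≼ (h ∷ hs)
    ≼-skip gs h hs (u , ≤⋁) = u ∘ π₂ , (begin
      map (u ∘ π₂) ⋁[ gs ]               ≈⟨ map-∘ π₂ u _ ⟩
      map π₂ (map u ⋁[ gs ])             ≤⟨ map-mono π₂ ≤⋁ ⟩
      map π₂ ⋁[ hs ]                     ≤⟨ y≤x∨y _ _ ⟩
      map π₁ (elt S h) ∨ map π₂ ⋁[ hs ]  ≈⟨ ⋁[∷] h hs ⟨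
      ⋁[ h ∷ hs ]                        ∎)
      where open ≤-Reasoning poset

    ≼-keep : ∀ {m n} g (gs : Vector (Index S) m) (hs : Vector (Index S) n)
           → gs ≼ hs → (g ∷ gs) ≼ (g ∷ hs)
    ≼-keep g gs hs (u , ≤⋁) = u′ , (begin
      map u′ ⋁[ g ∷ gs ]                              ≈⟨ map-cong u′ (⋁[∷] g gs) ⟩
      map u′ (map π₁ (elt S g) ∨ map π₂ ⋁[ gs ])      ≈⟨ map-∨ u′ _ _ ⟩
      map u′ (map π₁ (elt S g)) ∨ map u′ (map π₂ ⋁[ gs ])
        ≈⟨ B.∨-cong (map-π₁-⟨,⟩ π₁ (u ∘ π₂) _) (map-π₂-⟨,⟩ π₁ (u ∘ π₂) _) ⟩
      map π₁ (elt S g) ∨ map (u ∘ π₂) ⋁[ gs ]         ≈⟨ B.∨-congˡ (map-∘ π₂ u _) ⟩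
      map π₁ (elt S g) ∨ map π₂ (map u ⋁[ gs ])       ≤⟨ ∨-monotonic ≤-refl (map-mono π₂ ≤⋁) ⟩
      map π₁ (elt S g) ∨ map π₂ ⋁[ hs ]               ≈⟨ ⋁[∷] g hs ⟨
      ⋁[ g ∷ hs ]                                     ∎)
      where
      open ≤-Reasoning poset
      u′ = ⟨ π₁ , u ∘ π₂ ⟩

    ≼-++ˡ : ∀ m {n} (gs : Vector (Index S) m) (hs : Vector (Index S) n) → gs ≼ (gs ++ hs)
    ≼-++ˡ zero    gs hs = []≼ hs
    ≼-++ˡ (suc m) gs hs = ≼-keep (head gs) (tail gs) (tail gs ++ hs) (≼-++ˡ m (tail gs) hs)

    ≼-++ʳ : ∀ m {n} (gs : Vector (Index S) m) (hs : Vector (Index S) n) → hs ≼ (gs ++ hs)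
    ≼-++ʳ zero    gs hs = ≼-refl hs
    ≼-++ʳ (suc m) gs hs = ≼-skip hs (head gs) (tail gs ++ hs) (≼-++ʳ m (tail gs) hs)

    ⋁[]-refine : ∀ {a} {F : Family D a} → IsUniversalFilter D F
               → ∀ {m n} (gs : Vector (Index S) m) (hs : Vector (Index S) n)
               → gs ≼ hs → ⋁[ gs ] ∈ F Π[ gs ] → ⋁[ hs ] ∈ F Π[ hs ]
    ⋁[]-refine isF gs hs (u , ≤⋁) ⋁∈F =
      IsFilter.upward (filter _) (stable u ⋁∈F) (x≤y⇒x∧y≈x ≤⋁)
      where open IsUniversalFilter isF

    ⋁[]∈ideal : ∀ {a} {I : Family D a} → IsUniversalIdeal D I → (∀ i → elt S i ∈ I (obj S i))
              → ∀ n (gs : Vector (Index S) n) → ⋁[ gs ] ∈ I Π[ gs ]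
    ⋁[]∈ideal isI gen∈I zero    gs = IsUniversalIdeal.⊥∈ isI
    ⋁[]∈ideal isI gen∈I (suc n) gs =
      downward (⊗-join (gen∈I (head gs)) (⋁[]∈ideal isI gen∈I n (tail gs)))
        (x≤y⇒x∧y≈x (≤-reflexive (⋁[∷] (head gs) (tail gs))))
      where open IsUniversalIdeal isI

  ⟨_⟩ⁱ : ∀ {ι} → Generators ι → Family D (ι ⊔ h ⊔ ℓ)
  ⟨ S ⟩ⁱ X φ = Σ ℕ λ n → Σ (Vector (Index S) n) λ gs → ⋁[ gs ] ∈ ⟨ singleton φ ⟩ᶠ Π[ gs ]
    where open GeneratorJoins S

  module _ {ι} (S : Generators ι) where
    open GeneratorJoins S

    ⟨⟩ⁱ-isUniversalIdeal : IsUniversalIdeal D ⟨ S ⟩ⁱ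
    ⟨⟩ⁱ-isUniversalIdeal = record
      { reflect  = λ m f α (n , gs , ⋁∈) →
          n , gs , ⟨singleton⟩-⊆ (m , (λ j → tt , f j) , ≤-refl) _ ⋁∈
      ; downward = λ {x = x} (n , gs , ⋁∈) x≤y → n , gs ,
          ⟨singleton⟩-⊆ (⟨⟩ᶠ-resp-≤ (singleton x) (⟨⟩ᶠ-generator (singleton x) tt)
                                     (x∧y≈x⇒x≤y x≤y)) _ ⋁∈
      ; ⊗-join   = λ { (m , gs , ⋁∈₁) (n , hs , ⋁∈₂) → m + n , gs ++ hs ,
          ⟨⟩ᶠ-resp-≤ _ (⟨singleton⟩-⊗
            (⋁[]-refine (⟨⟩ᶠ-isUniversalFilter _) gs (gs ++ hs) (≼-++ˡ m gs hs) ⋁∈₁)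
            (⋁[]-refine (⟨⟩ᶠ-isUniversalFilter _) hs (gs ++ hs) (≼-++ʳ m gs hs) ⋁∈₂))
            (∨-least ≤-refl ≤-refl) }
      ; ⊥∈       = 0 , [] , ⟨⟩ᶠ-generator (singleton _) tt
      }

    ⟨⟩ⁱ-generator : ∀ i → elt S i ∈ ⟨ S ⟩ⁱ (obj S i)
    ⟨⟩ⁱ-generator i = 1 , i ∷ [] ,
      ⟨⟩ᶠ-resp-≤ (singleton _) (⟨⟩ᶠ-instance (singleton _) (tt , π₁)) (x≤x∨y _ _)

    ⟨⟩ⁱ-least : ∀ {g} (I : Family D g) → IsUniversalIdeal D I
              → (∀ i → elt S i ∈ I (obj S i)) → _⊆ᶠ_ D ⟨ S ⟩ⁱ I
    ⟨⟩ⁱ-least I isI gen∈I X {φ} (n , gs , m , is , ≤⋁) =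
      reflect m (proj₂ ∘′ is) φ (downward (⋁[]∈ideal isI gen∈I n gs) (x≤y⇒x∧y≈x ≤⋁))
      where open IsUniversalIdeal isI

  Element : ∀ {a} → Family D a → Set (o ⊔ c ⊔ a)
  Element A = Σ Obj λ X → Σ (Car (P X)) λ α → α ∈ A X

  elementsOf : ∀ {a} → Family D a → Generators (o ⊔ c ⊔ a)
  elementsOf A = record { Index = Element A ; obj = proj₁ ; elt = λ (_ , α , _) → α }

  module _ {a} (A : Family D a) where

    ⟨elements⟩ᶠ-isGenerated : ∀ g → IsGeneratedUniversalFilter D g A ⟨ elementsOf A ⟩ᶠ
    ⟨elements⟩ᶠ-isGenerated g = record
      { isUniversalFilter = ⟨⟩ᶠ-isUniversalFilter (elementsOf A)
      ; contains          = λ X α∈A → ⟨⟩ᶠ-generator (elementsOf A) (X , _ , α∈A)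
      ; least             = λ F isF A⊆F →
          ⟨⟩ᶠ-least (elementsOf A) F isF (λ (X , _ , α∈A) → A⊆F X α∈A)
      }

    ⟨elements⟩ⁱ-isGenerated : ∀ g → IsGeneratedUniversalIdeal D g A ⟨ elementsOf A ⟩ⁱ
    ⟨elements⟩ⁱ-isGenerated g = record
      { isUniversalIdeal = ⟨⟩ⁱ-isUniversalIdeal (elementsOf A)
      ; contains         = λ X α∈A → ⟨⟩ⁱ-generator (elementsOf A) (X , _ , α∈A)
      ; least            = λ I isI A⊆I →
          ⟨⟩ⁱ-least (elementsOf A) I isI (λ (X , _ , α∈A) → A⊆I X α∈A)
      }

    FilterOf⊆⟨elements⟩ᶠ : _⊆ᶠ_ D (FilterOf D A) ⟨ elementsOf A ⟩ᶠ
    FilterOf⊆⟨elements⟩ᶠ X (n , Y , α , α∈A , f , ≤φ) =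
      n , (λ i → (Y i , α i , α∈A i) , f i) , x∧y≈x⇒x≤y ≤φ

    ⟨elements⟩ᶠ⊆FilterOf : _⊆ᶠ_ D ⟨ elementsOf A ⟩ᶠ (FilterOf D A)
    ⟨elements⟩ᶠ⊆FilterOf X (n , is , ≤φ) =
      n , (λ i → proj₁ (proj₁ (is i))) , (λ i → proj₁ (proj₂ (proj₁ (is i)))) ,
      (λ i → proj₂ (proj₂ (proj₁ (is i)))) , (λ i → proj₂ (is i)) , x≤y⇒x∧y≈x ≤φ

    IdealOf⊆⟨elements⟩ⁱ : _⊆ᶠ_ D (IdealOf D A) ⟨ elementsOf A ⟩ⁱ
    IdealOf⊆⟨elements⟩ⁱ X (n , Y , α , α∈A , m , f , ≤⋁) =
      n , (λ i → Y i , α i , α∈A i) , m , (λ j → tt , f j) , x∧y≈x⇒x≤y ≤⋁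

    ⟨elements⟩ⁱ⊆IdealOf : _⊆ᶠ_ D ⟨ elementsOf A ⟩ⁱ (IdealOf D A)
    ⟨elements⟩ⁱ⊆IdealOf X (n , gs , m , is , ≤⋁) =
      n , (proj₁ ∘′ gs) , (λ i → proj₁ (proj₂ (gs i))) , (λ i → proj₂ (proj₂ (gs i))) ,
      m , (proj₂ ∘′ is) , x≤y⇒x∧y≈x ≤⋁

lemma3p14 : ∀ {o h c ℓ a g : Level} {C : FPCategory o h} (D : BooleanDoctrine C c ℓ)
              (A : Family D a)
              → IsGeneratedUniversalFilter D g A (FilterOf D A)
                × IsGeneratedUniversalIdeal D g A (IdealOf D A)
lemma3p14 {g = g} D A =
  IsGeneratedUniversalFilter-resp D (⟨elements⟩ᶠ⊆FilterOf D A) (FilterOf⊆⟨elements⟩ᶠ D A)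
    (⟨elements⟩ᶠ-isGenerated D A g) ,
  IsGeneratedUniversalIdeal-resp D (⟨elements⟩ⁱ⊆IdealOf D A) (IdealOf⊆⟨elements⟩ⁱ D A)
    (⟨elements⟩ⁱ-isGenerated D A g)
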